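{- Let $G$ be a graph of order $n$ with a neighborhood-prime labeling $f$, and let $u_1,u_2\in V(G)$ with $f(u_1)=1$ and $f(u_2)=n$. Suppose $u_1u_2$ is not an edge of $G$ and that $|N(u_1)|>1$ or $|N(u_2)|>1$. Let $G'$ be the graph obtained by contracting $u_1$ and $u_2$ into a single vertex $w$. Then $G'$ has a neighborhood-prime labeling $g$ with $g(w)=1$ and $g(v)=f(v)$ for all other $v\in V(G')$.
   Context: A neighborhood-prime labeling of a simple graph $G$ with $N$ vertices is a bijection $f:V(G)\to\{1,\ldots,N\}$ such that for every vertex $v$ with $\deg(v)>1$, $\gcd\{f(u):u\in N(v)\}=1$, where $N(v)$ (or $N_G(v)$) is the set of vertices adjacent to $v$ in $G$. The contraction of vertices $u_1$ and $u_2$ of $G$ produces the graph $G'$ in which $u_1,u_2$ are replaced by a single new vertex $w$ with $N_{G'}(w)=N_G(u_1)\cup N_G(u_2)$, all other adjacencies unchanged. -}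

module Defs where

open import Data.Nat using (ℕ; zero; suc; _<_)
open import Data.Nat.GCD using (gcd)
open import Data.Bool using (Bool; true; false; if_then_else_; _∧_; _∨_; not)
open import Data.Fin using (Fin; toℕ; punchIn; _≟_)
open import Data.Fin.Subset using (Subset; ∣_∣)
open import Data.Vec using (tabulate; foldr; zip)
open import Data.Vec as Vec using (allFin)
open import Data.Product using (_×_)
open import Relation.Nullary.Decidable using (⌊_⌋)
open import Relation.Binary.PropositionalEquality using (_≡_)
open import Function.Definitions using (Bijective)

Graph : ℕ → Set
Graph n = Fin n → Fin n → Bool

IsSimpleGraph : ∀ {n} → Graph n → Set
IsSimpleGraph {n} G = (∀ u v → G u v ≡ G v u) × (∀ v → G v v ≡ false)

N : ∀ {n} → Graph n → Fin n → Subset n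
N G v = tabulate (λ u → G v u)

deg : ∀ {n} → Graph n → Fin n → ℕ
deg G v = ∣ N G v ∣

-- gcd of the values h(u) for u in the subset S (gcd of the empty set is 0).
gcdOver : ∀ {n} → (Fin n → ℕ) → Subset n → ℕ
gcdOver {n} h S =
  foldr _ (λ { (b Data.Product., i) acc → if b then gcd (h i) acc else acc }) 0 (zip S (allFin n))

-- A labeling f : V → {1..n} is encoded as a map Fin n → Fin n; the label of v is 1 + toℕ (f v).
label : ∀ {n} → (Fin n → Fin n) → Fin n → ℕ
label f v = suc (toℕ (f v))

IsNPLabeling : ∀ {n} → Graph n → (Fin n → Fin n) → Set
IsNPLabeling {n} G f =
  Bijective _≡_ _≡_ f × (∀ v → 1 < deg G v → gcdOver (label f) (N G v) ≡ 1)

-- The vertices of G' are Fin m; vertex x of G' corresponds to the vertex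
-- punchIn u₂ x of G (i.e. the vertices of G other than u₂, in order), and the
-- vertex corresponding to u₁ is the new contracted vertex w.
img : ∀ {m} → (u₂ : Fin (suc m)) → Fin m → Fin (suc m)
img u₂ x = punchIn u₂ x

isW : ∀ {m} → (u₁ u₂ : Fin (suc m)) → Fin m → Bool
isW u₁ u₂ x = ⌊ img u₂ x ≟ u₁ ⌋

-- Adjacency of G': N_{G'}(w) = N_G(u₁) ∪ N_G(u₂), other adjacencies unchanged.
contract : ∀ {m} → Graph (suc m) → (u₁ u₂ : Fin (suc m)) → Graph m
contract G u₁ u₂ x y =
  if ⌊ x ≟ y ⌋ then false
  else (G (img u₂ x) (img u₂ y)
        ∨ (isW u₁ u₂ x ∧ G u₂ (img u₂ y))
        ∨ (isW u₁ u₂ y ∧ G (img u₂ x) u₂))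

-- Since f(u₂) = n is the largest label, f restricted to V(G) ∖ {u₂} is already a bijection onto
-- {1,…,n-1}, and it gives w the label 1 of u₁.  A vertex of G' adjacent to w has a neighbour labelled 1;
-- any other vertex of G' has the same neighbourhood as in G.  Finally w inherits all neighbours of u₁
-- and of u₂, one of which has degree > 1 and hence neighbour-gcd 1, and enlarging a neighbourhood
-- can only shrink its gcd.
module Submission where

open import Defs
open import Data.Nat using (ℕ; suc; _<_)
open import Data.Fin using (Fin; toℕ)
open import Data.Bool using (Bool; true; false)
open import Data.Product using (Σ; _×_)
open import Data.Sum using (_⊎_)
open import Relation.Binary.PropositionalEquality using (_≡_)

open import Data.Nat.Properties using (suc-injective; ≤∧≢⇒<; <-irrefl; n≮0)
open import Data.Nat.Divisibility using (_∣_; ∣-trans; ∣1⇒≡1; _∣0)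
open import Data.Nat.GCD using (gcd; gcd[m,n]∣m; gcd[m,n]∣n; gcd-greatest)
open import Data.Fin using (zero; suc; punchIn; punchOut; fromℕ<; inject₁; _≟_)
open import Data.Fin.Properties
  using (toℕ-injective; toℕ-fromℕ<; toℕ≤pred[n]; toℕ<n; toℕ-inject₁;
         punchIn-injective; punchInᵢ≢i; punchIn-punchOut)
open import Data.Fin.Subset using (∣_∣)
open import Data.Vec using (Vec; []; _∷_; lookup; tabulate; zip; foldr; allFin)
open import Data.Vec.Properties using (lookup∘tabulate; lookup-allFin; tabulate-cong)
open import Data.Bool using (if_then_else_; _∧_; _∨_)
open import Data.Bool.Properties using (∨-zeroʳ; ∨-identityʳ; ∧-zeroʳ)
open import Data.Product using (_,_; proj₁; proj₂)
open import Data.Sum using (inj₁; inj₂; [_,_])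
open import Function using (_∘_)
open import Function.Definitions using (Bijective; Injective; Surjective)
open import Relation.Nullary using (yes; no; contradiction)
open import Relation.Binary.PropositionalEquality
  using (refl; sym; trans; cong; subst; _≢_; module ≡-Reasoning)

-- gcdOver h S is gcdAlong h S (allFin n); the index vector is generalised for the induction.
gcdAlong : ∀ {n k} → (Fin n → ℕ) → Vec Bool k → Vec (Fin n) k → ℕ
gcdAlong h S is = foldr _ (λ { (b , i) acc → if b then gcd (h i) acc else acc }) 0 (zip S is)

gcdAlong-∣ : ∀ {n k} (h : Fin n → ℕ) (S : Vec Bool k) (is : Vec (Fin n) k) (p : Fin k) →
             lookup S p ≡ true → gcdAlong h S is ∣ h (lookup is p)
gcdAlong-∣ h (true  ∷ S) (i ∷ is) zero    refl = gcd[m,n]∣m (h i) _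
gcdAlong-∣ h (true  ∷ S) (i ∷ is) (suc p) Sp   = ∣-trans (gcd[m,n]∣n (h i) _) (gcdAlong-∣ h S is p Sp)
gcdAlong-∣ h (false ∷ S) (i ∷ is) (suc p) Sp   = gcdAlong-∣ h S is p Sp

∣-gcdAlong : ∀ {n k} (h : Fin n → ℕ) (S : Vec Bool k) (is : Vec (Fin n) k) {d : ℕ} →
             (∀ p → lookup S p ≡ true → d ∣ h (lookup is p)) → d ∣ gcdAlong h S is
∣-gcdAlong h []          []       d∣ = _ ∣0
∣-gcdAlong h (true  ∷ S) (i ∷ is) d∣ = gcd-greatest (d∣ zero refl) (∣-gcdAlong h S is (d∣ ∘ suc))
∣-gcdAlong h (false ∷ S) (i ∷ is) d∣ = ∣-gcdAlong h S is (d∣ ∘ suc)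

gcdOver-∣ : ∀ {n} (h : Fin n → ℕ) (s : Fin n → Bool) {p : Fin n} →
            s p ≡ true → gcdOver h (tabulate s) ∣ h p
gcdOver-∣ {n} h s {p} sp = subst (λ q → gcdOver h (tabulate s) ∣ h q) (lookup-allFin p)
  (gcdAlong-∣ h (tabulate s) (allFin n) p (trans (lookup∘tabulate s p) sp))

∣-gcdOver : ∀ {n} (h : Fin n → ℕ) (s : Fin n → Bool) {d : ℕ} →
            (∀ p → s p ≡ true → d ∣ h p) → d ∣ gcdOver h (tabulate s)
∣-gcdOver {n} h s {d} d∣ = ∣-gcdAlong h (tabulate s) (allFin n) λ p sp →
  subst (λ q → d ∣ h q) (sym (lookup-allFin p)) (d∣ p (trans (sym (lookup∘tabulate s p)) sp))

gcdOver-punchIn-∣ : ∀ {m} (u : Fin (suc m)) (h : Fin (suc m) → ℕ) (h′ : Fin m → ℕ)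
                    (s : Fin (suc m) → Bool) (t : Fin m → Bool) →
                    (∀ y → h′ y ≡ h (punchIn u y)) → s u ≡ false →
                    (∀ y → s (punchIn u y) ≡ true → t y ≡ true) →
                    gcdOver h′ (tabulate t) ∣ gcdOver h (tabulate s)
gcdOver-punchIn-∣ u h h′ s t h′≗h su s⇒t = ∣-gcdOver h s λ j sj →
  let u≢j : u ≢ j
      u≢j = λ { refl → contradiction (trans (sym sj) su) λ () }
      j′ = punchIn-punchOut u≢j
  in subst (gcdOver h′ (tabulate t) ∣_) (trans (h′≗h _) (cong h j′))
       (gcdOver-∣ h′ t (s⇒t _ (trans (cong s j′) sj)))

∣tabulate∣-punchIn : ∀ {m} (s : Fin (suc m) → Bool) (u : Fin (suc m)) →
                     s u ≡ false → ∣ tabulate s ∣ ≡ ∣ tabulate (s ∘ punchIn u) ∣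
∣tabulate∣-punchIn s zero su rewrite su = refl
∣tabulate∣-punchIn {suc m} s (suc u) su with s zero
... | true  = cong suc (∣tabulate∣-punchIn (s ∘ suc) u su)
... | false = ∣tabulate∣-punchIn (s ∘ suc) u su

module RemoveTop {m} (f : Fin (suc m) → Fin (suc m)) (f-bij : Bijective _≡_ _≡_ f)
                 (u : Fin (suc m)) (fu≡m : toℕ (f u) ≡ m) where

  private
    f∘punchIn<m : ∀ x → toℕ (f (punchIn u x)) < m
    f∘punchIn<m x = ≤∧≢⇒< (toℕ≤pred[n] (f (punchIn u x)))
      λ eq → punchInᵢ≢i u x (proj₁ f-bij (toℕ-injective (trans eq (sym fu≡m))))

  removeTop : Fin m → Fin m
  removeTop x = fromℕ< (f∘punchIn<m x)

  toℕ-removeTop : ∀ x → toℕ (removeTop x) ≡ toℕ (f (punchIn u x))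
  toℕ-removeTop x = toℕ-fromℕ< (f∘punchIn<m x)

  removeTop-injective : Injective _≡_ _≡_ removeTop
  removeTop-injective {x} {y} eq = punchIn-injective u x y (proj₁ f-bij (toℕ-injective (begin
    toℕ (f (punchIn u x)) ≡⟨ sym (toℕ-removeTop x) ⟩
    toℕ (removeTop x)     ≡⟨ cong toℕ eq ⟩
    toℕ (removeTop y)     ≡⟨ toℕ-removeTop y ⟩
    toℕ (f (punchIn u y)) ∎)))
    where open ≡-Reasoning

  removeTop-surjective : Surjective _≡_ _≡_ removeTop
  removeTop-surjective y = punchOut u≢v , λ { refl → toℕ-injective (begin
      toℕ (removeTop (punchOut u≢v))     ≡⟨ toℕ-removeTop _ ⟩
      toℕ (f (punchIn u (punchOut u≢v))) ≡⟨ cong (toℕ ∘ f) (punchIn-punchOut u≢v) ⟩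
      toℕ (f v)                         ≡⟨ cong toℕ fv≡y ⟩
      toℕ (inject₁ y)                   ≡⟨ toℕ-inject₁ y ⟩
      toℕ y                             ∎) }
    where
    open ≡-Reasoning
    v : Fin (suc m)
    v = proj₁ (proj₂ f-bij (inject₁ y))
    fv≡y : f v ≡ inject₁ y
    fv≡y = proj₂ (proj₂ f-bij (inject₁ y)) refl
    u≢v : u ≢ v
    u≢v refl = <-irrefl (trans (sym (toℕ-inject₁ y)) (trans (cong toℕ (sym fv≡y)) fu≡m)) (toℕ<n y)

  removeTop-bijective : Bijective _≡_ _≡_ removeTop
  removeTop-bijective = removeTop-injective , removeTop-surjective

module Contraction {m} (G : Graph (suc m)) (G-simple : IsSimpleGraph G)
                   (u₁ u₂ : Fin (suc m)) (u₁u₂∉G : G u₁ u₂ ≡ false) where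

  G′ : Graph m
  G′ = contract G u₁ u₂

  private
    G-irrefl : ∀ v → G v v ≡ false
    G-irrefl = proj₂ G-simple

    true≢false : ∀ {b} → b ≡ true → b ≢ false
    true≢false refl ()

    contract-≢ : ∀ {x y} → x ≢ y → G′ x y ≡ (G (img u₂ x) (img u₂ y)
                   ∨ (isW u₁ u₂ x ∧ G u₂ (img u₂ y)) ∨ (isW u₁ u₂ y ∧ G (img u₂ x) u₂))
    contract-≢ {x} {y} x≢y with x ≟ y
    ... | yes x≡y = contradiction x≡y x≢y
    ... | no _    = refl

    contract-keeps-edge : ∀ {x y} → x ≢ y → G (img u₂ x) (img u₂ y) ≡ true → G′ x y ≡ true
    contract-keeps-edge x≢y xy rewrite contract-≢ x≢y | xy = refl

    contract-w-gets-edge-of-u₂ : ∀ {x y} → x ≢ y → isW u₁ u₂ x ≡ true →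
                                 G u₂ (img u₂ y) ≡ true → G′ x y ≡ true
    contract-w-gets-edge-of-u₂ {x} {y} x≢y isWx u₂y
      rewrite contract-≢ x≢y | isWx | u₂y = ∨-zeroʳ (G (img u₂ x) (img u₂ y))

    contract-edge-of-u₂-to-w : ∀ {x y} → x ≢ y → isW u₁ u₂ y ≡ true →
                               G (img u₂ x) u₂ ≡ true → G′ x y ≡ true
    contract-edge-of-u₂-to-w {x} {y} x≢y isWy xu₂
      rewrite contract-≢ x≢y | isWy | xu₂
            | ∨-zeroʳ (isW u₁ u₂ x ∧ G u₂ (img u₂ y)) = ∨-zeroʳ (G (img u₂ x) (img u₂ y))

  isW⇒img≡u₁ : ∀ {x} → isW u₁ u₂ x ≡ true → img u₂ x ≡ u₁
  isW⇒img≡u₁ {x} isWx with img u₂ x ≟ u₁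
  ... | yes eq = eq
  isW⇒img≡u₁ () | no _

  adj-u₁⇒adj-w : ∀ {x} → isW u₁ u₂ x ≡ true → ∀ y → G u₁ (img u₂ y) ≡ true → G′ x y ≡ true
  adj-u₁⇒adj-w {x} isWx y u₁y =
    contract-keeps-edge x≢y (subst (λ v → G v (img u₂ y) ≡ true) (sym (isW⇒img≡u₁ isWx)) u₁y)
    where
    x≢y : x ≢ y
    x≢y refl = true≢false (subst (λ v → G u₁ v ≡ true) (isW⇒img≡u₁ isWx) u₁y) (G-irrefl u₁)

  adj-u₂⇒adj-w : ∀ {x} → isW u₁ u₂ x ≡ true → ∀ y → G u₂ (img u₂ y) ≡ true → G′ x y ≡ true
  adj-u₂⇒adj-w {x} isWx y u₂y = contract-w-gets-edge-of-u₂ x≢y isWx u₂y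
    where
    x≢y : x ≢ y
    x≢y refl = true≢false (subst (λ v → G u₂ v ≡ true) (isW⇒img≡u₁ isWx) u₂y) (trans (proj₁ G-simple u₂ u₁) u₁u₂∉G)

  adj-u₂⇒adj-w′ : ∀ {x y} → isW u₁ u₂ y ≡ true → G (img u₂ x) u₂ ≡ true → G′ x y ≡ true
  adj-u₂⇒adj-w′ {x} {y} isWy xu₂ = contract-edge-of-u₂-to-w x≢y isWy xu₂
    where
    x≢y : x ≢ y
    x≢y refl = true≢false (subst (λ v → G v u₂ ≡ true) (isW⇒img≡u₁ isWy) xu₂) u₁u₂∉G

  contract-away-from-w : ∀ {x} → isW u₁ u₂ x ≡ false → G (img u₂ x) u₂ ≡ false →
                         ∀ y → G′ x y ≡ G (img u₂ x) (img u₂ y)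
  contract-away-from-w {x} isWx xu₂ y with x ≟ y
  ... | yes refl = sym (G-irrefl (img u₂ x))
  ... | no _ rewrite isWx | xu₂ | ∧-zeroʳ (isW u₁ u₂ y) = ∨-identityʳ (G (img u₂ x) (img u₂ y))

  img≡u₁⇒isW : ∀ {x} → img u₂ x ≡ u₁ → isW u₁ u₂ x ≡ true
  img≡u₁⇒isW {x} img≡u₁ with img u₂ x ≟ u₁
  ... | yes _  = refl
  ... | no img≢u₁ = contradiction img≡u₁ img≢u₁

  deg-away-from-w : ∀ {x} → isW u₁ u₂ x ≡ false → G (img u₂ x) u₂ ≡ false →
                    deg G′ x ≡ deg G (img u₂ x)
  deg-away-from-w {x} isWx xu₂ = begin
    ∣ tabulate (G′ x) ∣                        ≡⟨ cong ∣_∣ (tabulate-cong (contract-away-from-w isWx xu₂)) ⟩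
    ∣ tabulate (G (img u₂ x) ∘ punchIn u₂) ∣   ≡⟨ sym (∣tabulate∣-punchIn (G (img u₂ x)) u₂ xu₂) ⟩
    ∣ tabulate (G (img u₂ x)) ∣                ∎
    where open ≡-Reasoning

true-or-false : ∀ b → b ≡ true ⊎ b ≡ false
true-or-false true  = inj₁ refl
true-or-false false = inj₂ refl

module ContractedLabeling {m} (G : Graph (suc m)) (G-simple : IsSimpleGraph G)
                          (f : Fin (suc m) → Fin (suc m)) (f-np : IsNPLabeling G f)
                          (u₁ u₂ : Fin (suc m)) (f[u₁]≡1 : label f u₁ ≡ 1) (f[u₂]≡n : label f u₂ ≡ suc m)
                          (u₁u₂∉G : G u₁ u₂ ≡ false) where

  open RemoveTop f (proj₁ f-np) u₂ (suc-injective f[u₂]≡n) public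
  open Contraction G G-simple u₁ u₂ u₁u₂∉G

  label-removeTop : ∀ x → label removeTop x ≡ label f (img u₂ x)
  label-removeTop x = cong suc (toℕ-removeTop x)

  label-removeTop-w : ∀ x → isW u₁ u₂ x ≡ true → label removeTop x ≡ 1
  label-removeTop-w x isWx =
    trans (label-removeTop x) (trans (cong (label f) (isW⇒img≡u₁ isWx)) f[u₁]≡1)

  private
    gcd′ : Fin m → ℕ
    gcd′ x = gcdOver (label removeTop) (N G′ x)

    gcd′∣1-of-inherited : ∀ {x} v → G v u₂ ≡ false → (∀ y → G v (img u₂ y) ≡ true → G′ x y ≡ true) →
                          1 < deg G v → gcd′ x ∣ 1
    gcd′∣1-of-inherited {x} v vu₂ adj d = subst (gcd′ x ∣_) (proj₂ f-np v d)
      (gcdOver-punchIn-∣ u₂ (label f) (label removeTop) (G v) (G′ x) label-removeTop vu₂ adj)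

    gcd′∣1 : (1 < deg G u₁ ⊎ 1 < deg G u₂) → ∀ x → 1 < deg G′ x → gcd′ x ∣ 1
    gcd′∣1 deg>1 x d′ with true-or-false (isW u₁ u₂ x) | true-or-false (G (img u₂ x) u₂)
    ... | inj₁ isWx | _ =
      [ gcd′∣1-of-inherited u₁ u₁u₂∉G (adj-u₁⇒adj-w isWx)
      , gcd′∣1-of-inherited u₂ (proj₂ G-simple u₂) (adj-u₂⇒adj-w isWx) ] deg>1
    ... | inj₂ isWx | inj₁ xu₂ =
      subst (gcd′ x ∣_) (label-removeTop-w w w-isW)
        (gcdOver-∣ (label removeTop) (G′ x) (adj-u₂⇒adj-w′ w-isW xu₂))
      where
      u₂≢u₁ : u₂ ≢ u₁
      u₂≢u₁ refl = n≮0 (subst (toℕ x <_) (suc-injective (trans (sym f[u₂]≡n) f[u₁]≡1)) (toℕ<n x))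
      w : Fin m
      w = punchOut u₂≢u₁
      w-isW : isW u₁ u₂ w ≡ true
      w-isW = img≡u₁⇒isW (punchIn-punchOut u₂≢u₁)
    ... | inj₂ isWx | inj₂ xu₂ =
      gcd′∣1-of-inherited (img u₂ x) xu₂ (λ y xy → trans (contract-away-from-w isWx xu₂ y) xy)
        (subst (1 <_) (deg-away-from-w isWx xu₂) d′)

  removeTop-neighbourhood-prime : (1 < deg G u₁ ⊎ 1 < deg G u₂) → IsNPLabeling G′ removeTop
  removeTop-neighbourhood-prime deg>1 = removeTop-bijective , λ x d′ → ∣1⇒≡1 (gcd′∣1 deg>1 x d′)

mainTheorem5 : (m : ℕ) (G : Graph (suc m)) → IsSimpleGraph G
    → (f : Fin (suc m) → Fin (suc m)) → IsNPLabeling G f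
    → (u₁ u₂ : Fin (suc m))
    → label f u₁ ≡ 1 → label f u₂ ≡ suc m
    → G u₁ u₂ ≡ false
    → (1 < deg G u₁ ⊎ 1 < deg G u₂)
    → Σ (Fin m → Fin m) (λ g → IsNPLabeling (contract G u₁ u₂) g
    × (∀ x → isW u₁ u₂ x ≡ true → label g x ≡ 1)
    × (∀ x → isW u₁ u₂ x ≡ false → label g x ≡ label f (img u₂ x)))
mainTheorem5 m G G-simple f f-np u₁ u₂ f[u₁]≡1 f[u₂]≡n u₁u₂∉G deg>1 =
  removeTop , removeTop-neighbourhood-prime deg>1 , label-removeTop-w , λ x _ → label-removeTop x
  where open ContractedLabeling G G-simple f f-np u₁ u₂ f[u₁]≡1 f[u₂]≡n u₁u₂∉G
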